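{- $F_0^{W_3}(q)=1$, and for $n\geq 2$, $$F_{2n-2}^{W_3}(q)=(q^{n-1}+1)F_{2n-4}^{W_3}(q)+\sum_{k=2}^{n-1}q^{k(n-k)+\binom{n-k}{2}}F_{2k-4}^{W_3}(q).$$
   Context: $S_n(132,3412)$ is the set of permutations of $[n]$ containing no subsequence order isomorphic to $132$ and none order isomorphic to $3412$. $inv(\sigma)$ is the number of inversions of $\sigma$. For $n\geq 1$ define $F_{2n-2}^{W_3}(q)=\sum_{\sigma\in S_n(132,3412)}q^{inv(\sigma)}$. -}

module Defs where

open import Data.Nat using (ℕ; zero; suc; _+_; _*_; _∸_; _<ᵇ_; _≡ᵇ_)
open import Data.Bool using (Bool; true; false; _∧_; not; if_then_else_)
open import Data.List using (List; []; _∷_; map; concatMap; upTo; length; foldr; replicate; _++_; zip)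
open import Data.Bool.ListAction using (all; any)
open import Data.Product using (_×_; _,_)
open import Relation.Binary.PropositionalEquality using (_≡_)

-- Permutations of [n], encoded as one-line notation with values 0..n-1.

words : ℕ → ℕ → List (List ℕ)
words zero    k = [] ∷ []
words (suc n) k = concatMap (λ a → map (a ∷_) (words n k)) (upTo k)

bfilter : {A : Set} → (A → Bool) → List A → List A
bfilter p []       = []
bfilter p (x ∷ xs) = if p x then x ∷ bfilter p xs else bfilter p xs

distinct : List ℕ → Bool
distinct []       = true
distinct (x ∷ xs) = not (any (x ≡ᵇ_) xs) ∧ distinct xs

perms : ℕ → List (List ℕ)
perms n = bfilter distinct (words n n)

subsequences : List ℕ → List (List ℕ)
subsequences []       = [] ∷ []
subsequences (x ∷ xs) = map (x ∷_) (subsequences xs) ++ subsequences xs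

_==_ : Bool → Bool → Bool
true  == b = b
false == b = not b

sameOrder : List (ℕ × ℕ) → Bool
sameOrder []             = true
sameOrder ((x , p) ∷ r) =
  all (λ { (y , q) → ((x <ᵇ y) == (p <ᵇ q)) ∧ ((y <ᵇ x) == (q <ᵇ p)) }) r
  ∧ sameOrder r

orderIso : List ℕ → List ℕ → Bool
orderIso xs ps = (length xs ≡ᵇ length ps) ∧ sameOrder (zip xs ps)

contains : List ℕ → List ℕ → Bool
contains σ π = any (λ s → orderIso s π) (subsequences σ)

avoids132-3412 : List ℕ → Bool
avoids132-3412 σ =
  not (contains σ (1 ∷ 3 ∷ 2 ∷ [])) ∧ not (contains σ (3 ∷ 4 ∷ 1 ∷ 2 ∷ []))

avoiders : ℕ → List (List ℕ)
avoiders n = bfilter avoids132-3412 (perms n)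

inv : List ℕ → ℕ
inv []       = 0
inv (x ∷ xs) = length (bfilter (λ y → y <ᵇ x) xs) + inv xs

-- Polynomials in q with ℕ coefficients: coefficient lists, lowest degree first.

Poly : Set
Poly = List ℕ

coeff : Poly → ℕ → ℕ
coeff []       _       = 0
coeff (a ∷ p)  zero    = a
coeff (a ∷ p)  (suc i) = coeff p i

-- polynomial equality: equal coefficients (trailing zeros irrelevant)
_≈_ : Poly → Poly → Set
p ≈ r = ∀ i → coeff p i ≡ coeff r i

infix 4 _≈_
infixl 6 _⊕_

_⊕_ : Poly → Poly → Poly
[]      ⊕ r       = r
(a ∷ p) ⊕ []      = a ∷ p
(a ∷ p) ⊕ (b ∷ r) = (a + b) ∷ (p ⊕ r)

zeroP : Poly
zeroP = []

oneP : Poly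
oneP = 1 ∷ []

shift : ℕ → Poly → Poly
shift k p = replicate k 0 ++ p

mono : ℕ → Poly
mono k = shift k oneP

sumP : List Poly → Poly
sumP = foldr _⊕_ zeroP

-- F n  =  F^{W_3}_{2n-2}(q) = Σ_{σ ∈ S_n(132,3412)} q^{inv σ}
F : ℕ → Poly
F n = sumP (map (λ σ → mono (inv σ)) (avoiders n))

-- Let σ avoid 132 and 3412 and have maximum M, so σ = xs M ys. For x in xs and y in ys,
-- x < y would make x M y a 132, so every entry of ys lies below every entry of xs; hence
-- ys consists of 0, …, m−1 (m its length) and xs of m, …, M−1. If xs is non-empty, with
-- first entry x, two increasing entries u < v of ys would make x M u v a 3412, so ys is
-- decreasing. Thus either σ = M τ with τ an avoider of length M (contributing q^M F(M)), or
-- σ = (α + m) M (m−1) ⋯ 1 0 with α an avoider of length k ≥ 1, k + m = M (contributing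
-- q^((k+1)m + C(m,2)) F(k)); conversely all these permutations avoid both patterns and are
-- pairwise distinct. The term m = 0 is the F(M) of the recurrence, the others are its sum.

module Submission where

open import Algebra.Structures using (IsCommutativeMonoid)
open import Data.Bool using (Bool; true; false; T; not)
open import Data.Bool.ListAction using (any)
open import Data.Bool.Properties using (T-∧; T-≡; T-not-≡)
open import Data.Empty using (⊥; ⊥-elim)
open import Data.List using (List; []; _∷_; [_]; _++_; map; concatMap; filterᵇ; length; upTo; downFrom)
open import Data.List.Properties
  using (∷-injective; ∷-injectiveʳ; map-injective; ++-cancelʳ; length-++; length-map; length-upTo; length-downFrom)
open import Data.List.Membership.Propositional using (_∈_; _∉_; find; lose)
import Data.List.Membership.Propositional.Properties as ∈
open import Data.List.Membership.Propositional.Properties.WithK using (unique∧set⇒bag)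
open import Data.List.Relation.Binary.BagAndSetEquality using (∼bag⇒↭)
open import Data.List.Relation.Binary.Disjoint.Propositional using (Disjoint)
open import Data.List.Relation.Binary.Permutation.Propositional using (_↭_; ↭⇒↭ₛ′)
open import Data.List.Relation.Binary.Permutation.Propositional.Properties using () renaming (map⁺ to ↭-map⁺)
open import Data.List.Relation.Binary.Permutation.Setoid.Properties using (foldr-commMonoid)
open import Data.List.Relation.Binary.Sublist.Propositional
  using (_⊆_; []; _∷_; _∷ʳ_; ⊆-refl; ⊆-trans; lookup; from∈; to∈; minimum)
open import Data.List.Relation.Binary.Sublist.Propositional.Properties
  using (All-resp-⊆; ++⁺; ++⁺ˡ; ++⁺ʳ; ∷⁻; map⁺)
open import Data.List.Relation.Unary.All as All using (All; []; _∷_)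
import Data.List.Relation.Unary.All.Properties as Allₚ
open import Data.List.Relation.Unary.AllPairs using (AllPairs; []; _∷_)
import Data.List.Relation.Unary.AllPairs.Properties as AllPairsₚ
open import Data.List.Relation.Unary.Any as Any using (here; there)
import Data.List.Relation.Unary.Any.Properties as Anyₚ
open import Data.List.Relation.Unary.Unique.Propositional using (Unique)
import Data.List.Relation.Unary.Unique.Propositional.Properties as Unique
open import Data.Nat using (ℕ; zero; suc; _+_; _*_; _∸_; _≤_; _<_; _<ᵇ_; _≡ᵇ_; _≟_; z≤n; s≤s; z<s)
open import Data.Nat.Combinatorics using (_C_; nC1≡n; nCk+nC[k+1]≡[n+1]C[k+1])
open import Data.Nat.Properties
open import Data.Nat.Tactic.RingSolver using (solve-∀)
open import Data.List.Membership.DecPropositional _≟_ using (_∈?_)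
open import Data.Product using (∃-syntax; _×_; _,_; proj₁; proj₂; uncurry)
open import Data.Sum using (_⊎_; inj₁; inj₂)
open import Function using (id; _∘_; _⇔_; mk⇔; Equivalence)
open import Relation.Binary.Definitions using (tri<; tri≈; tri>)
open import Relation.Binary.PropositionalEquality
  using (_≡_; _≢_; refl; sym; trans; cong; cong₂; subst; ≢-sym; module ≡-Reasoning)
import Relation.Binary.Reasoning.Setoid
open import Relation.Binary.Structures using (IsEquivalence)
open import Relation.Nullary using (¬_; yes; no)
open import Relation.Nullary.Decidable using (T?)

open import Defs

open Equivalence using (to; from)

concatMap-unique : ∀ {A B : Set} (f : A → List B) {is} → Unique is →
  (∀ {i} → i ∈ is → Unique (f i)) →
  (∀ {i j} → i ∈ is → j ∈ is → i ≢ j → Disjoint (f i) (f j)) →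
  Unique (concatMap f is)
concatMap-unique f {[]}     _          _      _        = []
concatMap-unique f {i ∷ is} (i∉ ∷ uis) unique disjoint = Unique.++⁺
  (unique (here refl))
  (concatMap-unique f uis (unique ∘ there) (λ p q → disjoint (there p) (there q)))
  (λ (x∈fi , x∈rest) →
    let j , j∈ , x∈fj = find (∈.∈-concatMap⁻ f {xs = is} x∈rest)
    in disjoint (here refl) (there j∈) (All.lookup i∉ j∈) (x∈fi , x∈fj))

++-∷-injective : ∀ {A : Set} {c : A} xs {ys xs′ ys′} → c ∉ xs → c ∉ xs′ →
  xs ++ c ∷ ys ≡ xs′ ++ c ∷ ys′ → xs ≡ xs′ × ys ≡ ys′
++-∷-injective []       {xs′ = []}      _   _    refl = refl , refl
++-∷-injective []       {xs′ = _ ∷ _}   _   c∉′  refl = ⊥-elim (c∉′ (here refl))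
++-∷-injective (_ ∷ _)  {xs′ = []}      c∉  _    refl = ⊥-elim (c∉ (here refl))
++-∷-injective (x ∷ xs) {xs′ = _ ∷ xs′} c∉  c∉′  eq
  with refl , eq′ ← ∷-injective eq
  with refl , refl ← ++-∷-injective xs (c∉ ∘ there) (c∉′ ∘ there) eq′ = refl , refl

∈-++-∷⁻ : ∀ {A : Set} (xs : List A) {c ys w} → w ∈ xs ++ c ∷ ys → w ∈ xs ⊎ w ≡ c ⊎ w ∈ ys
∈-++-∷⁻ xs w∈ with ∈.∈-++⁻ xs w∈
... | inj₁ w∈xs         = inj₁ w∈xs
... | inj₂ (here w≡c)   = inj₂ (inj₁ w≡c)
... | inj₂ (there w∈ys) = inj₂ (inj₂ w∈ys)

unique-length-≤ : ∀ {A : Set} {xs ys : List A} → Unique xs → (∀ {x} → x ∈ xs → x ∈ ys) →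
  length xs ≤ length ys
unique-length-≤ {xs = []}     _          _    = z≤n
unique-length-≤ {xs = x ∷ xs} (x∉ ∷ uxs) incl
  with as , bs , refl ← ∈.∈-∃++ (incl (here refl)) = begin
    suc (length xs)             ≤⟨ s≤s (unique-length-≤ uxs xs⊆as++bs) ⟩
    suc (length (as ++ bs))     ≡⟨ cong suc (length-++ as) ⟩
    suc (length as + length bs) ≡⟨ +-suc (length as) (length bs) ⟨
    length as + suc (length bs) ≡⟨ length-++ as ⟨
    length (as ++ x ∷ bs)       ∎
  where
  open ≤-Reasoning
  remove-x : ∀ as {bs y} → y ∈ as ++ x ∷ bs → y ≢ x → y ∈ as ++ bs
  remove-x []       (here refl) y≢x = ⊥-elim (y≢x refl)
  remove-x []       (there y∈)  _   = y∈
  remove-x (a ∷ as) (here refl) _   = here refl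
  remove-x (a ∷ as) (there y∈)  y≢x = there (remove-x as y∈ y≢x)
  xs⊆as++bs : ∀ {y} → y ∈ xs → y ∈ as ++ bs
  xs⊆as++bs y∈ = remove-x as (incl (there y∈)) (≢-sym (All.lookup x∉ y∈))

unique-bounded-length-≤ : ∀ {xs k} → Unique xs → All (_< k) xs → length xs ≤ k
unique-bounded-length-≤ {xs} {k} u bnd =
  subst (length xs ≤_) (length-upTo k) (unique-length-≤ u (∈.∈-upTo⁺ ∘ All.lookup bnd))

⊆-++⁻ : ∀ {A : Set} (xs : List A) {ys s} → s ⊆ xs ++ ys →
  ∃[ s₁ ] ∃[ s₂ ] (s ≡ s₁ ++ s₂ × s₁ ⊆ xs × s₂ ⊆ ys)
⊆-++⁻ []       p          = [] , _ , refl , [] , p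
⊆-++⁻ (x ∷ xs) (refl ∷ p) with s₁ , s₂ , refl , p₁ , p₂ ← ⊆-++⁻ xs p = x ∷ s₁ , s₂ , refl , refl ∷ p₁ , p₂
⊆-++⁻ (x ∷ xs) (.x ∷ʳ p)  with s₁ , s₂ , refl , p₁ , p₂ ← ⊆-++⁻ xs p = s₁ , s₂ , refl , x ∷ʳ p₁ , p₂

⊆-map⁻ : ∀ {A B : Set} (f : A → B) (xs : List A) {s} → s ⊆ map f xs → ∃[ t ] (s ≡ map f t × t ⊆ xs)
⊆-map⁻ f []       []         = [] , refl , []
⊆-map⁻ f (x ∷ xs) (refl ∷ p) with t , refl , q ← ⊆-map⁻ f xs p = x ∷ t , refl , refl ∷ q
⊆-map⁻ f (x ∷ xs) (_ ∷ʳ p)   with t , refl , q ← ⊆-map⁻ f xs p = t , refl , x ∷ʳ q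

AllPairs-resp-⊇ : ∀ {A : Set} {R : A → A → Set} {xs ys} → xs ⊆ ys → AllPairs R ys → AllPairs R xs
AllPairs-resp-⊇ []         []         = []
AllPairs-resp-⊇ (y ∷ʳ p)   (_ ∷ rys)  = AllPairs-resp-⊇ p rys
AllPairs-resp-⊇ (refl ∷ p) (ry ∷ rys) = All-resp-⊆ p ry ∷ AllPairs-resp-⊇ p rys

AllPairs-from-pairs : ∀ {A : Set} {R : A → A → Set} {ys} →
  (∀ {u v} → u ∷ v ∷ [] ⊆ ys → R u v) → AllPairs R ys
AllPairs-from-pairs {ys = []}     _    = []
AllPairs-from-pairs {ys = y ∷ ys} pair =
  All.tabulate (λ v∈ → pair (refl ∷ from∈ v∈)) ∷ AllPairs-from-pairs (λ p → pair (y ∷ʳ p))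

Unique-⊆⇒≢ : ∀ {A : Set} {xs} {u v : A} → Unique xs → u ∷ v ∷ [] ⊆ xs → u ≢ v
Unique-⊆⇒≢ uxs p with (u≢v ∷ []) ∷ _ ← AllPairs-resp-⊇ p uxs = u≢v

-- Permutations and pattern avoidance

record IsPerm (n : ℕ) (σ : List ℕ) : Set where
  field
    length≡ : length σ ≡ n
    bounded : All (_< n) σ
    unique  : Unique σ

IsPerm-size-unique : ∀ {n n′ σ} → IsPerm n σ → IsPerm n′ σ → n ≡ n′
IsPerm-size-unique perm perm′ = trans (sym (IsPerm.length≡ perm)) (IsPerm.length≡ perm′)

IsPerm-∈ : ∀ {n σ v} → IsPerm n σ → v < n → v ∈ σ
IsPerm-∈ {σ = σ} {v} perm v<n with v ∈? σ
... | yes v∈σ = v∈σ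
... | no  v∉σ =
  ⊥-elim (<-irrefl length≡ (unique-bounded-length-≤ (Allₚ.¬Any⇒All¬ σ v∉σ ∷ unique) (v<n ∷ bounded)))
  where open IsPerm perm

Decreasing : List ℕ → Set
Decreasing = AllPairs (λ x y → y < x)

downFrom-bounded : ∀ m → All (_< m) (downFrom m)
downFrom-bounded m = All.tabulate ∈.∈-downFrom⁻

downFrom-decreasing : ∀ m → Decreasing (downFrom m)
downFrom-decreasing m = AllPairsₚ.applyDownFrom⁺₁ id m (λ j<i _ → j<i)

decreasing≡downFrom : ∀ {m ys} → Decreasing ys → All (_< m) ys → (∀ {v} → v < m → v ∈ ys) →
  ys ≡ downFrom m
decreasing≡downFrom {zero}  {[]}     _ _ _ = refl
decreasing≡downFrom {zero}  {y ∷ ys} _ (() ∷ _) _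
decreasing≡downFrom {suc m} {[]}     _ _ complete with () ← complete (n<1+n m)
decreasing≡downFrom {suc m} {y ∷ ys} (ys<y ∷ dec) (y<1+m ∷ _) complete with complete (n<1+n m)
... | there m∈ys = ⊥-elim (<⇒≱ (All.lookup ys<y m∈ys) (≤-pred y<1+m))
... | here refl  = cong (m ∷_) (decreasing≡downFrom dec ys<y complete′)
  where
  complete′ : ∀ {v} → v < m → v ∈ ys
  complete′ v<m with complete (m<n⇒m<1+n v<m)
  ... | here refl  = ⊥-elim (<-irrefl refl v<m)
  ... | there v∈ys = v∈ys

Is132 : List ℕ → Set
Is132 (a ∷ b ∷ c ∷ []) = a < c × c < b
Is132 _                = ⊥

Is3412 : List ℕ → Set
Is3412 (a ∷ b ∷ c ∷ d ∷ []) = c < d × d < a × a < b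
Is3412 _                    = ⊥

Occurs : (List ℕ → Set) → List ℕ → Set
Occurs P σ = ∃[ s ] (s ⊆ σ × P s)

record Avoids (σ : List ℕ) : Set where
  field
    no132  : ¬ Occurs Is132 σ
    no3412 : ¬ Occurs Is3412 σ

bfilter≡filterᵇ : ∀ {A : Set} (p : A → Bool) xs → bfilter p xs ≡ filterᵇ p xs
bfilter≡filterᵇ p []       = refl
bfilter≡filterᵇ p (x ∷ xs) with p x
... | true  = cong (x ∷_) (bfilter≡filterᵇ p xs)
... | false = bfilter≡filterᵇ p xs

∈-bfilter⇔ : ∀ {A : Set} (p : A → Bool) {xs x} → x ∈ bfilter p xs ⇔ (x ∈ xs × T (p x))
∈-bfilter⇔ p {xs} rewrite bfilter≡filterᵇ p xs =
  mk⇔ (∈.∈-filter⁻ (T? ∘ p)) (λ (x∈ , px) → ∈.∈-filter⁺ (T? ∘ p) x∈ px)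

bfilter-unique : ∀ {A : Set} (p : A → Bool) {xs} → Unique xs → Unique (bfilter p xs)
bfilter-unique p {xs} u rewrite bfilter≡filterᵇ p xs = Unique.filter⁺ _ u

T-not⇔¬ : ∀ {b} → T (not b) ⇔ (¬ T b)
T-not⇔¬ {false} = mk⇔ (λ _ ()) (λ _ → _)
T-not⇔¬ {true}  = mk⇔ (λ ()) (λ ¬t → ¬t _)

any-≡ᵇ⇔∈ : ∀ {x} xs → T (any (x ≡ᵇ_) xs) ⇔ x ∈ xs
any-≡ᵇ⇔∈ {x} xs = mk⇔
  (Any.map (≡ᵇ⇒≡ x _) ∘ Anyₚ.any⁻ _ xs)
  (Anyₚ.any⁺ _ ∘ Any.map (≡⇒≡ᵇ x _))

distinct⇔Unique : ∀ xs → T (distinct xs) ⇔ Unique xs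
distinct⇔Unique []       = mk⇔ (λ _ → []) (λ _ → _)
distinct⇔Unique (x ∷ xs) = mk⇔
  (λ t → let (fresh , rest) = to T-∧ t in
    Allₚ.¬Any⇒All¬ xs (to T-not⇔¬ fresh ∘ from (any-≡ᵇ⇔∈ xs)) ∷ to (distinct⇔Unique xs) rest)
  (λ { (fresh ∷ rest) → from T-∧
    (from T-not⇔¬ (Allₚ.All¬⇒¬Any fresh ∘ to (any-≡ᵇ⇔∈ xs)) , from (distinct⇔Unique xs) rest) })

∈-words⁻ : ∀ n k {σ} → σ ∈ words n k → length σ ≡ n × All (_< k) σ
∈-words⁻ zero    k (here refl) = refl , []
∈-words⁻ (suc n) k σ∈
  with a , a∈ , σ∈′ ← find (∈.∈-concatMap⁻ (λ a → map (a ∷_) (words n k)) {xs = upTo k} σ∈)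
  with τ , τ∈ , refl ← ∈.∈-map⁻ (a ∷_) σ∈′
  with len , bnd ← ∈-words⁻ n k τ∈
  = cong suc len , ∈.∈-upTo⁻ a∈ ∷ bnd

∈-words⁺ : ∀ n k {σ} → length σ ≡ n → All (_< k) σ → σ ∈ words n k
∈-words⁺ zero    k {[]}    refl []          = here refl
∈-words⁺ (suc n) k {a ∷ τ} len  (a<k ∷ bnd) =
  ∈.∈-concatMap⁺ (λ a → map (a ∷_) (words n k)) {xs = upTo k}
    (lose (∈.∈-upTo⁺ a<k) (∈.∈-map⁺ (a ∷_) (∈-words⁺ n k (suc-injective len) bnd)))

words-unique : ∀ n k → Unique (words n k)
words-unique zero    k = [] ∷ []
words-unique (suc n) k = concatMap-unique (λ a → map (a ∷_) (words n k)) (Unique.upTo⁺ k)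
  (λ _ → Unique.map⁺ ∷-injectiveʳ (words-unique n k))
  (λ _ _ a≢b (x∈a , x∈b) → a≢b (head-of x∈a x∈b))
  where
  head-of : ∀ {a b x} → x ∈ map (a ∷_) (words n k) → x ∈ map (b ∷_) (words n k) → a ≡ b
  head-of p q with _ , _ , refl ← ∈.∈-map⁻ _ p | _ , _ , refl ← ∈.∈-map⁻ _ q = refl

∈-subsequences⁻ : ∀ xs {s} → s ∈ subsequences xs → s ⊆ xs
∈-subsequences⁻ []       (here refl) = []
∈-subsequences⁻ (x ∷ xs) s∈ with ∈.∈-++⁻ (map (x ∷_) (subsequences xs)) s∈
... | inj₂ s∈′ = x ∷ʳ ∈-subsequences⁻ xs s∈′
... | inj₁ s∈′ with t , t∈ , refl ← ∈.∈-map⁻ (x ∷_) s∈′ = refl ∷ ∈-subsequences⁻ xs t∈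

∈-subsequences⁺ : ∀ {s} xs → s ⊆ xs → s ∈ subsequences xs
∈-subsequences⁺ []       []         = here refl
∈-subsequences⁺ (x ∷ xs) (.x ∷ʳ p)  = ∈.∈-++⁺ʳ (map (x ∷_) (subsequences xs)) (∈-subsequences⁺ xs p)
∈-subsequences⁺ (x ∷ xs) (refl ∷ p) = ∈.∈-++⁺ˡ (∈.∈-map⁺ (x ∷_) (∈-subsequences⁺ xs p))

<ᵇ≡true : ∀ {m n} → m < n → (m <ᵇ n) ≡ true
<ᵇ≡true m<n = to T-≡ (<⇒<ᵇ m<n)

<ᵇ≡false : ∀ {m n} → n ≤ m → (m <ᵇ n) ≡ false
<ᵇ≡false {m} {n} n≤m = to T-not-≡ (from T-not⇔¬ (λ t → <⇒≱ (<ᵇ⇒< m n t) n≤m))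

-- In the ⇒ directions below, every other outcome of the comparisons makes the order test
-- reduce to T false, so the single clause shown is exhaustive.
orderIso-132⇔ : ∀ s → T (orderIso s (1 ∷ 3 ∷ 2 ∷ [])) ⇔ Is132 s
orderIso-132⇔ s = mk⇔ (⇒ s) (⇐ s)
  where
  ⇒ : ∀ s → T (orderIso s (1 ∷ 3 ∷ 2 ∷ [])) → Is132 s
  ⇒ (a ∷ b ∷ c ∷ []) t
    with a <ᵇ b | b <ᵇ a | a <ᵇ c in a<c | c <ᵇ a | b <ᵇ c | c <ᵇ b in c<b
  ... | true | false | true | false | false | true = <ᵇ⇒< a c (from T-≡ a<c) , <ᵇ⇒< c b (from T-≡ c<b)
  ⇐ : ∀ s → Is132 s → T (orderIso s (1 ∷ 3 ∷ 2 ∷ []))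
  ⇐ (a ∷ b ∷ c ∷ []) (a<c , c<b)
    rewrite <ᵇ≡true (<-trans a<c c<b) | <ᵇ≡false (<⇒≤ (<-trans a<c c<b))
          | <ᵇ≡true a<c | <ᵇ≡false (<⇒≤ a<c) | <ᵇ≡false (<⇒≤ c<b) | <ᵇ≡true c<b = _

orderIso-3412⇔ : ∀ s → T (orderIso s (3 ∷ 4 ∷ 1 ∷ 2 ∷ [])) ⇔ Is3412 s
orderIso-3412⇔ s = mk⇔ (⇒ s) (⇐ s)
  where
  ⇒ : ∀ s → T (orderIso s (3 ∷ 4 ∷ 1 ∷ 2 ∷ [])) → Is3412 s
  ⇒ (a ∷ b ∷ c ∷ d ∷ []) t
    with a <ᵇ b in a<b | b <ᵇ a | a <ᵇ c | c <ᵇ a | a <ᵇ d | d <ᵇ a in d<a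
       | b <ᵇ c | c <ᵇ b | b <ᵇ d | d <ᵇ b | c <ᵇ d in c<d | d <ᵇ c
  ... | true | false | false | true | false | true | false | true | false | true | true | false =
    <ᵇ⇒< c d (from T-≡ c<d) , <ᵇ⇒< d a (from T-≡ d<a) , <ᵇ⇒< a b (from T-≡ a<b)
  ⇐ : ∀ s → Is3412 s → T (orderIso s (3 ∷ 4 ∷ 1 ∷ 2 ∷ []))
  ⇐ (a ∷ b ∷ c ∷ d ∷ []) (c<d , d<a , a<b) =
    ⇐′ (<-trans c<d d<a) (<-trans d<a a<b) (<-trans (<-trans c<d d<a) a<b)
    where
    ⇐′ : c < a → d < b → c < b → T (orderIso (a ∷ b ∷ c ∷ d ∷ []) (3 ∷ 4 ∷ 1 ∷ 2 ∷ []))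
    ⇐′ c<a d<b c<b
      rewrite <ᵇ≡true a<b | <ᵇ≡false (<⇒≤ a<b)
            | <ᵇ≡false (<⇒≤ c<a) | <ᵇ≡true c<a | <ᵇ≡false (<⇒≤ d<a) | <ᵇ≡true d<a
            | <ᵇ≡false (<⇒≤ c<b) | <ᵇ≡true c<b | <ᵇ≡false (<⇒≤ d<b) | <ᵇ≡true d<b
            | <ᵇ≡true c<d | <ᵇ≡false (<⇒≤ c<d) = _

contains⇔Occurs : ∀ {P : List ℕ → Set} π → (∀ s → T (orderIso s π) ⇔ P s) →
  ∀ σ → T (contains σ π) ⇔ Occurs P σ
contains⇔Occurs π iso σ = mk⇔
  (λ t → let s , s∈ , t′ = find (Anyₚ.any⁻ _ (subsequences σ) t)
         in s , ∈-subsequences⁻ σ s∈ , to (iso s) t′)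
  (λ (s , s⊆σ , ps) → Anyₚ.any⁺ _ (lose (∈-subsequences⁺ σ s⊆σ) (from (iso s) ps)))

avoids132-3412⇔Avoids : ∀ σ → T (avoids132-3412 σ) ⇔ Avoids σ
avoids132-3412⇔Avoids σ = mk⇔
  (λ t → let (t₁ , t₂) = to T-∧ t in record
    { no132  = to T-not⇔¬ t₁ ∘ from (contains⇔Occurs _ orderIso-132⇔ σ)
    ; no3412 = to T-not⇔¬ t₂ ∘ from (contains⇔Occurs _ orderIso-3412⇔ σ) })
  (λ av → from T-∧
    ( from T-not⇔¬ (Avoids.no132 av ∘ to (contains⇔Occurs _ orderIso-132⇔ σ))
    , from T-not⇔¬ (Avoids.no3412 av ∘ to (contains⇔Occurs _ orderIso-3412⇔ σ))))

∈-avoiders⇔ : ∀ n {σ} → σ ∈ avoiders n ⇔ (IsPerm n σ × Avoids σ)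
∈-avoiders⇔ n {σ} = mk⇔
  (λ σ∈ → let σ∈perms , avoids = to (∈-bfilter⇔ avoids132-3412) σ∈
              σ∈words , dist   = to (∈-bfilter⇔ distinct) σ∈perms
              len , bnd        = ∈-words⁻ n n σ∈words
          in record { length≡ = len ; bounded = bnd ; unique = to (distinct⇔Unique σ) dist }
           , to (avoids132-3412⇔Avoids σ) avoids)
  (λ (perm , av) → let open IsPerm perm in
    from (∈-bfilter⇔ avoids132-3412)
      ( from (∈-bfilter⇔ distinct) (∈-words⁺ n n length≡ bounded , from (distinct⇔Unique σ) unique)
      , from (avoids132-3412⇔Avoids σ) av))

∈-avoiders⇒IsPerm : ∀ {n σ} → σ ∈ avoiders n → IsPerm n σ
∈-avoiders⇒IsPerm σ∈ = proj₁ (to (∈-avoiders⇔ _) σ∈)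

avoiders-unique : ∀ n → Unique (avoiders n)
avoiders-unique n = bfilter-unique avoids132-3412 (bfilter-unique distinct (words-unique n n))

-- Closure properties of avoidance

Avoids-⊆ : ∀ {xs ys} → xs ⊆ ys → Avoids ys → Avoids xs
Avoids-⊆ xs⊆ys av = record
  { no132  = λ (s , s⊆ , p) → no132  (s , ⊆-trans s⊆ xs⊆ys , p)
  ; no3412 = λ (s , s⊆ , p) → no3412 (s , ⊆-trans s⊆ xs⊆ys , p) }
  where open Avoids av

Is132-map-+ : ∀ m s → Is132 (map (m +_) s) ⇔ Is132 s
Is132-map-+ m s = mk⇔ (⇒ s) (⇐ s)
  where
  ⇒ : ∀ s → Is132 (map (m +_) s) → Is132 s
  ⇒ (a ∷ b ∷ c ∷ []) (a<c , c<b) = +-cancelˡ-< m a c a<c , +-cancelˡ-< m c b c<b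
  ⇐ : ∀ s → Is132 s → Is132 (map (m +_) s)
  ⇐ (a ∷ b ∷ c ∷ []) (a<c , c<b) = +-monoʳ-< m a<c , +-monoʳ-< m c<b

Is3412-map-+ : ∀ m s → Is3412 (map (m +_) s) ⇔ Is3412 s
Is3412-map-+ m s = mk⇔ (⇒ s) (⇐ s)
  where
  ⇒ : ∀ s → Is3412 (map (m +_) s) → Is3412 s
  ⇒ (a ∷ b ∷ c ∷ d ∷ []) (c<d , d<a , a<b) =
    +-cancelˡ-< m c d c<d , +-cancelˡ-< m d a d<a , +-cancelˡ-< m a b a<b
  ⇐ : ∀ s → Is3412 s → Is3412 (map (m +_) s)
  ⇐ (a ∷ b ∷ c ∷ d ∷ []) (c<d , d<a , a<b) = +-monoʳ-< m c<d , +-monoʳ-< m d<a , +-monoʳ-< m a<b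

Occurs-map⇔ : ∀ {P Q : List ℕ → Set} (f : ℕ → ℕ) → (∀ s → Q (map f s) ⇔ P s) →
  ∀ xs → Occurs Q (map f xs) ⇔ Occurs P xs
Occurs-map⇔ {Q = Q} f Q⇔P xs = mk⇔
  (λ (s , s⊆ , q) → let t , s≡ , t⊆ = ⊆-map⁻ f xs s⊆ in t , t⊆ , to (Q⇔P t) (subst Q s≡ q))
  (λ (t , t⊆ , p) → map f t , map⁺ f t⊆ , from (Q⇔P t) p)

Avoids-map-+⇔ : ∀ m xs → Avoids (map (m +_) xs) ⇔ Avoids xs
Avoids-map-+⇔ m xs = mk⇔
  (λ av → record
    { no132  = Avoids.no132  av ∘ from (Occurs-map⇔ (m +_) (Is132-map-+ m) xs)
    ; no3412 = Avoids.no3412 av ∘ from (Occurs-map⇔ (m +_) (Is3412-map-+ m) xs) })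
  (λ av → record
    { no132  = Avoids.no132  av ∘ to (Occurs-map⇔ (m +_) (Is132-map-+ m) xs)
    ; no3412 = Avoids.no3412 av ∘ to (Occurs-map⇔ (m +_) (Is3412-map-+ m) xs) })

Avoids-max-∷ : ∀ {M τ} → All (_< M) τ → Avoids τ → Avoids (M ∷ τ)
Avoids-max-∷ {M} {τ} τ<M av = record { no132 = no132′ ; no3412 = no3412′ }
  where
  open Avoids av
  no132′ : ¬ Occurs Is132 (M ∷ τ)
  no132′ (_ ∷ _ ∷ _ ∷ [] , refl ∷ p , a<c , _) = <-asym a<c (All.lookup τ<M (lookup p (there (here refl))))
  no132′ (s , _ ∷ʳ p , occ) = no132 (s , p , occ)
  no3412′ : ¬ Occurs Is3412 (M ∷ τ)
  no3412′ (_ ∷ _ ∷ _ ∷ _ ∷ [] , refl ∷ p , _ , _ , a<b) = <-asym a<b (All.lookup τ<M (lookup p (here refl)))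
  no3412′ (s , _ ∷ʳ p , occ) = no3412 (s , p , occ)

Avoids-++-max-∷ : ∀ {xs M ys} → Avoids xs → All (_< M) xs → Decreasing (M ∷ ys) →
  (∀ {x y} → x ∈ xs → y ∈ ys → y < x) → Avoids (xs ++ M ∷ ys)
Avoids-++-max-∷ {xs} {M} {ys} av xs<M dec ys<xs = record { no132 = no132′ ; no3412 = no3412′ }
  where
  open Avoids av
  decreasing : ∀ {s} → s ⊆ M ∷ ys → Decreasing s
  decreasing q = AllPairs-resp-⊇ q dec
  right-of-max : ∀ {x v} → x ∈ xs → [ v ] ⊆ M ∷ ys → x < v → v ≡ M
  right-of-max _  (refl ∷ _) _   = refl
  right-of-max x∈ (_ ∷ʳ q) x<v = ⊥-elim (<-asym x<v (ys<xs x∈ (to∈ q)))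

  no132′ : ¬ Occurs Is132 (xs ++ M ∷ ys)
  no132′ (a ∷ b ∷ c ∷ [] , s⊆ , a<c , c<b) with ⊆-++⁻ xs s⊆
  ... | [] , _ , refl , _ , q with (_ ∷ c<a ∷ []) ∷ _ ← decreasing q = <-asym a<c c<a
  ... | _ ∷ [] , _ , refl , p , q = <-asym a<c (ys<xs (to∈ p) (to∈ (∷⁻ q)))
  ... | _ ∷ _ ∷ [] , _ , refl , p , q with refl ← right-of-max (lookup p (here refl)) q a<c =
    <-asym c<b (All.lookup xs<M (lookup p (there (here refl))))
  ... | _ ∷ _ ∷ _ ∷ [] , [] , refl , p , _ = no132 (_ , p , a<c , c<b)

  no3412′ : ¬ Occurs Is3412 (xs ++ M ∷ ys)
  no3412′ (a ∷ b ∷ c ∷ d ∷ [] , s⊆ , c<d , d<a , a<b) with ⊆-++⁻ xs s⊆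
  ... | [] , _ , refl , _ , q with _ ∷ _ ∷ (d<c ∷ []) ∷ _ ← decreasing q = <-asym c<d d<c
  ... | _ ∷ [] , _ , refl , _ , q with _ ∷ (d<c ∷ []) ∷ _ ← decreasing q = <-asym c<d d<c
  ... | _ ∷ _ ∷ [] , _ , refl , _ , q with (d<c ∷ []) ∷ _ ← decreasing q = <-asym c<d d<c
  ... | _ ∷ _ ∷ _ ∷ [] , _ , refl , p , q with refl ← right-of-max (lookup p (there (there (here refl)))) q c<d =
    <-asym d<a (All.lookup xs<M (lookup p (here refl)))
  ... | _ ∷ _ ∷ _ ∷ _ ∷ [] , [] , refl , p , _ = no3412 (_ , p , c<d , d<a , a<b)

-- Inversions

smaller : ℕ → List ℕ → ℕ
smaller x ys = length (bfilter (_<ᵇ x) ys)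

smaller-++ : ∀ x xs ys → smaller x (xs ++ ys) ≡ smaller x xs + smaller x ys
smaller-++ x []       ys = refl
smaller-++ x (y ∷ xs) ys with y <ᵇ x
... | true  = cong suc (smaller-++ x xs ys)
... | false = smaller-++ x xs ys

smaller-all : ∀ {x ys} → All (_< x) ys → smaller x ys ≡ length ys
smaller-all {x} {[]}     []          = refl
smaller-all {x} {y ∷ ys} (y<x ∷ ys<x) rewrite <ᵇ≡true y<x = cong suc (smaller-all ys<x)

+-<ᵇ : ∀ m y x → (m + y <ᵇ m + x) ≡ (y <ᵇ x)
+-<ᵇ zero    y x = refl
+-<ᵇ (suc m) y x = +-<ᵇ m y x

smaller-map-+ : ∀ m x ys → smaller (m + x) (map (m +_) ys) ≡ smaller x ys
smaller-map-+ m x []       = refl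
smaller-map-+ m x (y ∷ ys) rewrite +-<ᵇ m y x with y <ᵇ x
... | true  = cong suc (smaller-map-+ m x ys)
... | false = smaller-map-+ m x ys

inv-map-+ : ∀ m α → inv (map (m +_) α) ≡ inv α
inv-map-+ m []      = refl
inv-map-+ m (a ∷ α) = cong₂ _+_ (smaller-map-+ m a α) (inv-map-+ m α)

inv-max-∷ : ∀ {M τ} → All (_< M) τ → inv (M ∷ τ) ≡ length τ + inv τ
inv-max-∷ {τ = τ} τ<M = cong (_+ inv τ) (smaller-all τ<M)

inv-++ : ∀ c xs ys → (∀ {x} → x ∈ xs → smaller x ys ≡ c) → inv (xs ++ ys) ≡ length xs * c + inv xs + inv ys
inv-++ c []       ys _  = refl
inv-++ c (x ∷ xs) ys c≡ = begin
  smaller x (xs ++ ys) + inv (xs ++ ys)                 ≡⟨ cong₂ _+_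
    (trans (smaller-++ x xs ys) (cong (smaller x xs +_) (c≡ (here refl)))) (inv-++ c xs ys (c≡ ∘ there)) ⟩
  smaller x xs + c + (length xs * c + inv xs + inv ys)  ≡⟨ rearrange (smaller x xs) c (length xs) (inv xs) (inv ys) ⟩
  c + length xs * c + (smaller x xs + inv xs) + inv ys  ∎
  where
  open ≡-Reasoning
  rearrange : ∀ s c l a b → s + c + (l * c + a + b) ≡ c + l * c + (s + a) + b
  rearrange = solve-∀

inv-downFrom : ∀ m → inv (downFrom m) ≡ m C 2
inv-downFrom zero    = refl
inv-downFrom (suc m) = begin
  smaller m (downFrom m) + inv (downFrom m) ≡⟨ cong₂ _+_ smaller-m (inv-downFrom m) ⟩
  m + m C 2                                 ≡⟨ cong (_+ m C 2) (nC1≡n m) ⟨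
  m C 1 + m C 2                             ≡⟨ nCk+nC[k+1]≡[n+1]C[k+1] m 1 ⟩
  suc m C 2                                 ∎
  where
  open ≡-Reasoning
  smaller-m : smaller m (downFrom m) ≡ m
  smaller-m = trans (smaller-all (downFrom-bounded m)) (length-downFrom m)

-- Splitting an avoider at its maximum

glue : ℕ → ℕ → List ℕ → List ℕ
glue M m α = map (m +_) α ++ M ∷ downFrom m

data Shape (M : ℕ) : List ℕ → Set where
  max-first  : ∀ {τ} → IsPerm M τ → Avoids τ → Shape M (M ∷ τ)
  max-inside : ∀ {k m α} → suc k + m ≡ M → IsPerm (suc k) α → Avoids α → Shape M (glue M m α)

map-+-∸ : ∀ m xs → All (m ≤_) xs → map (m +_) (map (_∸ m) xs) ≡ xs
map-+-∸ m []       []           = refl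
map-+-∸ m (x ∷ xs) (m≤x ∷ m≤xs) = cong₂ _∷_ (m+[n∸m]≡n m≤x) (map-+-∸ m xs m≤xs)

module AroundMaximum {M : ℕ} (xs ys : List ℕ)
  (perm : IsPerm (suc M) (xs ++ M ∷ ys)) (av : Avoids (xs ++ M ∷ ys)) where

  open IsPerm perm
  open Avoids av

  m : ℕ
  m = length ys

  left⊆ : xs ⊆ xs ++ M ∷ ys
  left⊆ = ++⁺ʳ (M ∷ ys) ⊆-refl

  right⊆ : ys ⊆ xs ++ M ∷ ys
  right⊆ = ++⁺ˡ xs (M ∷ʳ ⊆-refl)

  right-unique : Unique ys
  right-unique = AllPairs-resp-⊇ right⊆ unique

  left<M : ∀ {x} → x ∈ xs → x < M
  left<M x∈ = ≤∧≢⇒< (≤-pred (All.lookup bounded (∈.∈-++⁺ˡ x∈)))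
    (Unique-⊆⇒≢ unique (++⁺ (from∈ x∈) (refl ∷ minimum ys)))

  right<M : ∀ {y} → y ∈ ys → y < M
  right<M y∈ = ≤∧≢⇒< (≤-pred (All.lookup bounded (∈.∈-++⁺ʳ xs (there y∈))))
    (≢-sym (Unique-⊆⇒≢ unique (++⁺ (minimum xs) (refl ∷ from∈ y∈))))

  right<left : ∀ {x y} → x ∈ xs → y ∈ ys → y < x
  right<left {x} {y} x∈ y∈ with <-cmp y x
  ... | tri< y<x _ _ = y<x
  ... | tri≈ _ y≡x _ = ⊥-elim (Unique-⊆⇒≢ unique (++⁺ (from∈ x∈) (M ∷ʳ from∈ y∈)) (sym y≡x))
  ... | tri> _ _ x<y = ⊥-elim (no132 (_ , ++⁺ (from∈ x∈) (refl ∷ from∈ y∈) , x<y , right<M y∈))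

  right-decreasing : ∀ {x} → x ∈ xs → Decreasing ys
  right-decreasing {x} x∈ = AllPairs-from-pairs pair
    where
    pair : ∀ {u v} → u ∷ v ∷ [] ⊆ ys → v < u
    pair {u} {v} p with <-cmp v u
    ... | tri< v<u _ _ = v<u
    ... | tri≈ _ v≡u _ = ⊥-elim (Unique-⊆⇒≢ unique (++⁺ (minimum xs) (M ∷ʳ p)) (sym v≡u))
    ... | tri> _ _ u<v = ⊥-elim (no3412 (_ , ++⁺ (from∈ x∈) (refl ∷ p) , u<v ,
                                          right<left x∈ (lookup p (there (here refl))) , left<M x∈))

  m≤M : m ≤ M
  m≤M = ≤-pred (begin
    suc m                     ≤⟨ m≤n+m (suc m) (length xs) ⟩
    length xs + suc m         ≡⟨ length-++ xs ⟨
    length (xs ++ M ∷ ys)     ≡⟨ length≡ ⟩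
    suc M                     ∎)
    where open ≤-Reasoning

  right-complete : ∀ {v} → v < m → v ∈ ys
  right-complete {v} v<m with ∈-++-∷⁻ xs (IsPerm-∈ perm (m<n⇒m<1+n (<-≤-trans v<m m≤M)))
  ... | inj₁ v∈xs        =
    ⊥-elim (<⇒≱ v<m (unique-bounded-length-≤ right-unique (All.tabulate (right<left v∈xs))))
  ... | inj₂ (inj₁ refl) = ⊥-elim (<⇒≱ v<m m≤M)
  ... | inj₂ (inj₂ v∈ys) = v∈ys

  right-downward-closed : ∀ {y w} → y ∈ ys → w < y → w ∈ ys
  right-downward-closed y∈ w<y with ∈-++-∷⁻ xs (IsPerm-∈ perm (<-trans w<y (m<n⇒m<1+n (right<M y∈))))
  ... | inj₁ w∈xs        = ⊥-elim (<-asym w<y (right<left w∈xs y∈))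
  ... | inj₂ (inj₁ refl) = ⊥-elim (<-asym w<y (right<M y∈))
  ... | inj₂ (inj₂ w∈ys) = w∈ys

  right-bounded : All (_< m) ys
  right-bounded = All.tabulate λ {y} y∈ → subst (_≤ m) (length-upTo (suc y))
    (unique-length-≤ (Unique.upTo⁺ (suc y)) (λ w∈ → at-most y∈ (∈.∈-upTo⁻ w∈)))
    where
    at-most : ∀ {y w} → y ∈ ys → w < suc y → w ∈ ys
    at-most y∈ w<1+y with m<1+n⇒m<n∨m≡n w<1+y
    ... | inj₁ w<y  = right-downward-closed y∈ w<y
    ... | inj₂ refl = y∈

  right≡downFrom : ∀ {x} → x ∈ xs → ys ≡ downFrom m
  right≡downFrom x∈ = decreasing≡downFrom (right-decreasing x∈) right-bounded right-complete

  left≥m : ∀ {x} → x ∈ xs → m ≤ x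
  left≥m {x} x∈ with x <? m
  ... | yes x<m = ⊥-elim (Unique-⊆⇒≢ unique (++⁺ (from∈ x∈) (M ∷ʳ from∈ (right-complete x<m))) refl)
  ... | no  x≮m = ≮⇒≥ x≮m

  α : List ℕ
  α = map (_∸ m) xs

  left≡shifted : xs ≡ map (m +_) α
  left≡shifted = sym (map-+-∸ m xs (All.tabulate left≥m))

  length+m≡M : length xs + m ≡ M
  length+m≡M = suc-injective (begin
    suc (length xs + m)   ≡⟨ +-suc (length xs) m ⟨
    length xs + suc m     ≡⟨ length-++ xs ⟨
    length (xs ++ M ∷ ys) ≡⟨ length≡ ⟩
    suc M                 ∎)
    where open ≡-Reasoning

  α-perm : IsPerm (length xs) α
  α-perm = record
    { length≡ = length-map (_∸ m) xs
    ; bounded = Allₚ.map⁺ (All.tabulate λ x∈ →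
        subst (_ <_) (trans (cong (_∸ m) (sym length+m≡M)) (m+n∸n≡m (length xs) m))
          (∸-monoˡ-< (left<M x∈) (left≥m x∈)))
    ; unique  = Unique.map⁻ (subst Unique left≡shifted (AllPairs-resp-⊇ left⊆ unique)) }

  α-avoids : Avoids α
  α-avoids = to (Avoids-map-+⇔ m α) (subst Avoids left≡shifted (Avoids-⊆ left⊆ av))

shape : ∀ {M σ} → IsPerm (suc M) σ → Avoids σ → Shape M σ
shape {M} perm av with xs , ys , refl ← ∈.∈-∃++ (IsPerm-∈ perm (n<1+n M)) = split xs perm av
  where
  split : ∀ xs {ys} → IsPerm (suc M) (xs ++ M ∷ ys) → Avoids (xs ++ M ∷ ys) → Shape M (xs ++ M ∷ ys)
  split [] {ys} perm av = max-first
    (record { length≡ = suc-injective length≡ ; bounded = All.tabulate right<M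
            ; unique = right-unique })
    (Avoids-⊆ right⊆ av)
    where open AroundMaximum [] ys perm av
          open IsPerm perm
  split xs@(_ ∷ _) {ys} perm av =
    subst (Shape M) (sym (cong₂ (λ l r → l ++ M ∷ r) left≡shifted (right≡downFrom (here refl))))
      (max-inside length+m≡M α-perm α-avoids)
    where open AroundMaximum xs ys perm av

IsPerm-max-∷ : ∀ {M τ} → IsPerm M τ → IsPerm (suc M) (M ∷ τ)
IsPerm-max-∷ {M} perm = record
  { length≡ = cong suc length≡
  ; bounded = n<1+n M ∷ All.map m<n⇒m<1+n bounded
  ; unique  = All.map (λ τ<M M≡ → <-irrefl (sym M≡) τ<M) bounded ∷ unique }
  where open IsPerm perm

module Glue {k m M α} (k+m≡M : k + m ≡ M) (perm : IsPerm k α) where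

  open IsPerm perm

  m≤M : m ≤ M
  m≤M = subst (m ≤_) k+m≡M (m≤n+m m k)

  shifted-bounds : All (λ x → m ≤ x × x < M) (map (m +_) α)
  shifted-bounds = Allₚ.map⁺ (All.map (λ {a} a<k → m≤m+n m a ,
    subst (m + a <_) (trans (+-comm m k) k+m≡M) (+-monoʳ-< m a<k)) bounded)

  tail<M : All (_< M) (downFrom m)
  tail<M = All.map (λ y<m → <-≤-trans y<m m≤M) (downFrom-bounded m)

  M∉shifted : M ∉ map (m +_) α
  M∉shifted M∈ = <-irrefl refl (proj₂ (All.lookup shifted-bounds M∈))

  IsPerm-glue : IsPerm (suc M) (glue M m α)
  IsPerm-glue = record
    { length≡ = begin
        length (glue M m α)                               ≡⟨ length-++ (map (m +_) α) ⟩
        length (map (m +_) α) + suc (length (downFrom m)) ≡⟨ cong₂ (λ a b → a + suc b)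
                                                               (trans (length-map (m +_) α) length≡) (length-downFrom m) ⟩
        k + suc m                                         ≡⟨ +-suc k m ⟩
        suc (k + m)                                       ≡⟨ cong suc k+m≡M ⟩
        suc M                                             ∎
    ; bounded = Allₚ.++⁺ (All.map (m<n⇒m<1+n ∘ proj₂) shifted-bounds)
                         (n<1+n M ∷ All.map m<n⇒m<1+n tail<M)
    ; unique  = Unique.++⁺ (Unique.map⁺ (+-cancelˡ-≡ m _ _) unique)
                  (All.map (λ y<M M≡y → <-irrefl (sym M≡y) y<M) tail<M ∷ Unique.downFrom⁺ m)
                  disjoint }
    where
    open ≡-Reasoning
    disjoint : Disjoint (map (m +_) α) (M ∷ downFrom m)
    disjoint (x∈ , here refl) = M∉shifted x∈
    disjoint (x∈ , there x∈′) = <⇒≱ (∈.∈-downFrom⁻ x∈′) (proj₁ (All.lookup shifted-bounds x∈))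

  Avoids-glue : Avoids α → Avoids (glue M m α)
  Avoids-glue av = Avoids-++-max-∷ (from (Avoids-map-+⇔ m α) av) (All.map proj₂ shifted-bounds)
    (tail<M ∷ downFrom-decreasing m)
    (λ x∈ y∈ → <-≤-trans (∈.∈-downFrom⁻ y∈) (proj₁ (All.lookup shifted-bounds x∈)))

  inv-glue : inv (glue M m α) ≡ suc k * m + m C 2 + inv α
  inv-glue = begin
    inv (map (m +_) α ++ M ∷ downFrom m)
      ≡⟨ inv-++ m (map (m +_) α) (M ∷ downFrom m) smaller-tail ⟩
    length (map (m +_) α) * m + inv (map (m +_) α) + inv (M ∷ downFrom m)
      ≡⟨ cong₂ _+_ (cong₂ _+_ (cong (_* m) (trans (length-map (m +_) α) length≡)) (inv-map-+ m α)) inv-tail ⟩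
    k * m + inv α + (m + m C 2)
      ≡⟨ rearrange k m (inv α) (m C 2) ⟩
    suc k * m + m C 2 + inv α
      ∎
    where
    open ≡-Reasoning
    smaller-tail : ∀ {x} → x ∈ map (m +_) α → smaller x (M ∷ downFrom m) ≡ m
    smaller-tail x∈ with m≤x , x<M ← All.lookup shifted-bounds x∈ rewrite <ᵇ≡false (<⇒≤ x<M) =
      trans (smaller-all (All.map (λ y<m → <-≤-trans y<m m≤x) (downFrom-bounded m))) (length-downFrom m)
    inv-tail : inv (M ∷ downFrom m) ≡ m + m C 2
    inv-tail = trans (inv-max-∷ tail<M)
                     (cong₂ _+_ (length-downFrom m) (inv-downFrom m))
    rearrange : ∀ k m a c → k * m + a + (m + c) ≡ suc k * m + c + a
    rearrange = solve-∀

Shape⇒IsPerm×Avoids : ∀ {M σ} → Shape M σ → IsPerm (suc M) σ × Avoids σ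
Shape⇒IsPerm×Avoids (max-first perm av)      = IsPerm-max-∷ perm , Avoids-max-∷ (IsPerm.bounded perm) av
Shape⇒IsPerm×Avoids (max-inside e perm av) = Glue.IsPerm-glue e perm , Glue.Avoids-glue e perm av

glue-injective : ∀ {k k′ m m′ M α β} → k + m ≡ M → k′ + m′ ≡ M → IsPerm k α → IsPerm k′ β →
  glue M m α ≡ glue M m′ β → m ≡ m′ × α ≡ β
glue-injective {m = m} {m′} {α = α} {β} e e′ perm perm′ eq
  with left≡ , right≡ ← ++-∷-injective (map (m +_) α) (Glue.M∉shifted e perm) (Glue.M∉shifted e′ perm′) eq
  with refl ← trans (sym (length-downFrom m)) (trans (cong length right≡) (length-downFrom m′))
  = refl , map-injective (+-cancelˡ-≡ m _ _) left≡

max-first≢glue : ∀ {k m M α τ} → suc k + m ≡ M → IsPerm (suc k) α → M ∷ τ ≢ glue M m α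
max-first≢glue {α = a ∷ α} e perm eq = Glue.M∉shifted e perm (here (proj₁ (∷-injective eq)))

glue-injectiveʳ : ∀ {M m α β} → glue M m α ≡ glue M m β → α ≡ β
glue-injectiveʳ {M} {m} {α} {β} eq =
  map-injective (+-cancelˡ-≡ m _ _) (++-cancelʳ (M ∷ downFrom m) (map (m +_) α) (map (m +_) β) eq)

-- Index i of inner is the summation index of the recurrence: α has length i + 1 and the
-- decreasing tail has length j ∸ i.
module Decomposition (j : ℕ) where

  M : ℕ
  M = suc j

  inner : ℕ → List (List ℕ)
  inner i = map (glue M (j ∸ i)) (avoiders (suc i))

  first rest pieces : List (List ℕ)
  first  = map (M ∷_) (avoiders M)
  rest   = map (glue M 0) (avoiders M) ++ concatMap inner (upTo j)
  pieces = first ++ rest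

  suc-i+[j∸i]≡M : ∀ {i} → i < j → suc i + (j ∸ i) ≡ M
  suc-i+[j∸i]≡M i<j = cong suc (m+[n∸m]≡n (<⇒≤ i<j))

  ∈inner⁻ : ∀ {σ} → σ ∈ concatMap inner (upTo j) →
    ∃[ i ] ∃[ α ] (i < j × α ∈ avoiders (suc i) × σ ≡ glue M (j ∸ i) α)
  ∈inner⁻ σ∈
    with i , i∈ , σ∈′ ← find (∈.∈-concatMap⁻ inner {xs = upTo j} σ∈)
    with α , α∈ , σ≡ ← ∈.∈-map⁻ (glue M (j ∸ i)) σ∈′
    = i , α , ∈.∈-upTo⁻ i∈ , α∈ , σ≡

  ∈rest⁻ : ∀ {σ} → σ ∈ rest →
    ∃[ k ] ∃[ m ] ∃[ α ] (suc k + m ≡ M × α ∈ avoiders (suc k) × σ ≡ glue M m α)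
  ∈rest⁻ σ∈ with ∈.∈-++⁻ (map (glue M 0) (avoiders M)) σ∈
  ... | inj₁ σ∈′ with α , α∈ , σ≡ ← ∈.∈-map⁻ (glue M 0) σ∈′ = j , 0 , α , +-identityʳ M , α∈ , σ≡
  ... | inj₂ σ∈′ with i , α , i<j , α∈ , σ≡ ← ∈inner⁻ σ∈′ = i , j ∸ i , α , suc-i+[j∸i]≡M i<j , α∈ , σ≡

  ∈rest⁺ : ∀ {k m α} → suc k + m ≡ M → α ∈ avoiders (suc k) → glue M m α ∈ rest
  ∈rest⁺ {k} {zero} {α} e α∈ =
    ∈.∈-++⁺ˡ (∈.∈-map⁺ (glue M 0) (subst (λ n → α ∈ avoiders n) (trans (sym (+-identityʳ (suc k))) e) α∈))
  ∈rest⁺ {k} {suc m} {α} e α∈ = ∈.∈-++⁺ʳ (map (glue M 0) (avoiders M))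
    (∈.∈-concatMap⁺ inner {xs = upTo j} (lose (∈.∈-upTo⁺ k<j) glue∈inner))
    where
    k+1+m≡j : k + suc m ≡ j
    k+1+m≡j = suc-injective e
    k<j : k < j
    k<j = subst (k <_) k+1+m≡j (m<m+n k z<s)
    glue∈inner : glue M (suc m) α ∈ inner k
    glue∈inner = subst (λ m′ → glue M m′ α ∈ inner k) (trans (cong (_∸ k) (sym k+1+m≡j)) (m+n∸m≡n k (suc m)))
      (∈.∈-map⁺ (glue M (j ∸ k)) α∈)

  ∈pieces⇔Shape : ∀ {σ} → σ ∈ pieces ⇔ Shape M σ
  ∈pieces⇔Shape {σ} = mk⇔ ⇒ ⇐
    where
    ⇒ : σ ∈ pieces → Shape M σ
    ⇒ σ∈ with ∈.∈-++⁻ first σ∈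
    ... | inj₁ σ∈′ with τ , τ∈ , refl ← ∈.∈-map⁻ (M ∷_) σ∈′ = uncurry max-first (to (∈-avoiders⇔ M) τ∈)
    ... | inj₂ σ∈′ with k , m , α , e , α∈ , refl ← ∈rest⁻ σ∈′ =
      uncurry (max-inside e) (to (∈-avoiders⇔ (suc k)) α∈)
    ⇐ : Shape M σ → σ ∈ pieces
    ⇐ (max-first perm av)    = ∈.∈-++⁺ˡ (∈.∈-map⁺ (M ∷_) (from (∈-avoiders⇔ M) (perm , av)))
    ⇐ (max-inside e perm av) = ∈.∈-++⁺ʳ first (∈rest⁺ e (from (∈-avoiders⇔ _) (perm , av)))

  rest-unique : Unique rest
  rest-unique = Unique.++⁺
    (Unique.map⁺ glue-injectiveʳ (avoiders-unique M))
    (concatMap-unique inner (Unique.upTo⁺ j)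
      (λ {i} _ → Unique.map⁺ glue-injectiveʳ (avoiders-unique (suc i))) inner-disjoint)
    zero-vs-inner
    where
    inner-disjoint : ∀ {i i′} → i ∈ upTo j → i′ ∈ upTo j → i ≢ i′ → Disjoint (inner i) (inner i′)
    inner-disjoint {i} {i′} i∈ i′∈ i≢i′ (σ∈ , σ∈′)
      with α , α∈ , refl ← ∈.∈-map⁻ (glue M (j ∸ i)) σ∈
      with β , β∈ , eq ← ∈.∈-map⁻ (glue M (j ∸ i′)) σ∈′
      with _ , refl ← glue-injective (suc-i+[j∸i]≡M (∈.∈-upTo⁻ i∈)) (suc-i+[j∸i]≡M (∈.∈-upTo⁻ i′∈))
                        (∈-avoiders⇒IsPerm α∈) (∈-avoiders⇒IsPerm β∈) eq
      = i≢i′ (suc-injective (IsPerm-size-unique (∈-avoiders⇒IsPerm α∈) (∈-avoiders⇒IsPerm β∈)))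
    zero-vs-inner : Disjoint (map (glue M 0) (avoiders M)) (concatMap inner (upTo j))
    zero-vs-inner (σ∈ , σ∈′)
      with α , α∈ , refl ← ∈.∈-map⁻ (glue M 0) σ∈
      with i , β , i<j , β∈ , eq ← ∈inner⁻ σ∈′
      with 0≡j∸i , _ ← glue-injective (+-identityʳ M) (suc-i+[j∸i]≡M i<j)
                         (∈-avoiders⇒IsPerm α∈) (∈-avoiders⇒IsPerm β∈) eq
      = <-irrefl 0≡j∸i (m<n⇒0<n∸m i<j)

  pieces-unique : Unique pieces
  pieces-unique = Unique.++⁺ (Unique.map⁺ ∷-injectiveʳ (avoiders-unique M)) rest-unique first-vs-rest
    where
    first-vs-rest : Disjoint first rest
    first-vs-rest (σ∈ , σ∈′)
      with τ , _ , refl ← ∈.∈-map⁻ (M ∷_) σ∈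
      with _ , _ , _ , e , α∈ , eq ← ∈rest⁻ σ∈′
      = max-first≢glue e (∈-avoiders⇒IsPerm α∈) eq

  avoiders↭pieces : avoiders (suc M) ↭ pieces
  avoiders↭pieces = ∼bag⇒↭ (unique∧set⇒bag (avoiders-unique (suc M)) pieces-unique
    (mk⇔ (from ∈pieces⇔Shape ∘ uncurry shape ∘ to (∈-avoiders⇔ (suc M)))
         (from (∈-avoiders⇔ (suc M)) ∘ Shape⇒IsPerm×Avoids ∘ to ∈pieces⇔Shape)))

-- Generating polynomials

-- Defs._≈_ as a record: unlike a function type it determines p and r, so Agda can infer them.
record _≋_ (p r : Poly) : Set where
  constructor mk≋
  field coeff-≡ : ∀ i → coeff p i ≡ coeff r i

infix 4 _≋_

coeff-⊕ : ∀ p r i → coeff (p ⊕ r) i ≡ coeff p i + coeff r i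
coeff-⊕ []      r       i       = refl
coeff-⊕ (a ∷ p) []      i       = sym (+-identityʳ _)
coeff-⊕ (a ∷ p) (b ∷ r) zero    = refl
coeff-⊕ (a ∷ p) (b ∷ r) (suc i) = coeff-⊕ p r i

≋-isEquivalence : IsEquivalence _≋_
≋-isEquivalence = record
  { refl  = mk≋ λ _ → refl
  ; sym   = λ (mk≋ e) → mk≋ (sym ∘ e)
  ; trans = λ (mk≋ e) (mk≋ f) → mk≋ λ i → trans (e i) (f i) }

⊕-isCommutativeMonoid : IsCommutativeMonoid _≋_ _⊕_ zeroP
⊕-isCommutativeMonoid = record
  { isMonoid = record
    { isSemigroup = record
      { isMagma = record
        { isEquivalence = ≋-isEquivalence
        ; ∙-cong = λ {p} {p′} {r} {r′} (mk≋ e) (mk≋ f) → mk≋ λ i → begin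
            coeff (p ⊕ r) i        ≡⟨ coeff-⊕ p r i ⟩
            coeff p i + coeff r i  ≡⟨ cong₂ _+_ (e i) (f i) ⟩
            coeff p′ i + coeff r′ i ≡⟨ coeff-⊕ p′ r′ i ⟨
            coeff (p′ ⊕ r′) i      ∎ }
      ; assoc = λ p r s → mk≋ λ i → begin
          coeff ((p ⊕ r) ⊕ s) i               ≡⟨ trans (coeff-⊕ (p ⊕ r) s i) (cong (_+ coeff s i) (coeff-⊕ p r i)) ⟩
          coeff p i + coeff r i + coeff s i   ≡⟨ +-assoc (coeff p i) _ _ ⟩
          coeff p i + (coeff r i + coeff s i) ≡⟨ trans (coeff-⊕ p (r ⊕ s) i) (cong (coeff p i +_) (coeff-⊕ r s i)) ⟨
          coeff (p ⊕ (r ⊕ s)) i               ∎ }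
    ; identity = (λ p → mk≋ λ _ → refl) , (λ p → mk≋ λ i → trans (coeff-⊕ p [] i) (+-identityʳ _)) }
  ; comm = λ p r → mk≋ λ i → trans (coeff-⊕ p r i) (trans (+-comm (coeff p i) _) (sym (coeff-⊕ r p i))) }
  where open ≡-Reasoning

open IsCommutativeMonoid ⊕-isCommutativeMonoid public
  using ()
  renaming ( refl to ≋-refl; sym to ≋-sym; setoid to ≋-setoid
           ; ∙-cong to ⊕-cong; ∙-congˡ to ⊕-congˡ; assoc to ⊕-assoc)

∷-cong : ∀ a {p r} → p ≋ r → a ∷ p ≋ a ∷ r
∷-cong a (mk≋ e) = mk≋ λ { zero → refl ; (suc i) → e i }

shift-⊕ : ∀ k p r → shift k (p ⊕ r) ≋ shift k p ⊕ shift k r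
shift-⊕ zero    p r = ≋-refl
shift-⊕ (suc k) p r = ∷-cong 0 (shift-⊕ k p r)

shift-zeroP : ∀ k → shift k zeroP ≋ zeroP
shift-zeroP zero    = ≋-refl
shift-zeroP (suc k) = mk≋ λ { zero → refl ; (suc i) → _≋_.coeff-≡ (shift-zeroP k) i }

shift-mono : ∀ k n → shift k (mono n) ≡ mono (k + n)
shift-mono zero    n = refl
shift-mono (suc k) n = cong (0 ∷_) (shift-mono k n)

invSum : List (List ℕ) → Poly
invSum L = sumP (map (λ σ → mono (inv σ)) L)

module _ where
  open Relation.Binary.Reasoning.Setoid ≋-setoid

  invSum-++ : ∀ xs ys → invSum (xs ++ ys) ≋ invSum xs ⊕ invSum ys
  invSum-++ []       ys = ≋-refl
  invSum-++ (σ ∷ xs) ys = begin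
    mono (inv σ) ⊕ invSum (xs ++ ys)          ≈⟨ ⊕-congˡ (invSum-++ xs ys) ⟩
    mono (inv σ) ⊕ (invSum xs ⊕ invSum ys)    ≈⟨ ⊕-assoc (mono (inv σ)) _ _ ⟨
    mono (inv σ) ⊕ invSum xs ⊕ invSum ys      ∎

  invSum-↭ : ∀ {xs ys} → xs ↭ ys → invSum xs ≋ invSum ys
  invSum-↭ p = foldr-commMonoid ≋-setoid ⊕-isCommutativeMonoid (↭⇒↭ₛ′ ≋-isEquivalence (↭-map⁺ _ p))

  invSum-map : ∀ k (f : List ℕ → List ℕ) L → (∀ {τ} → τ ∈ L → inv (f τ) ≡ k + inv τ) →
    invSum (map f L) ≋ shift k (invSum L)
  invSum-map k f []      _   = ≋-sym (shift-zeroP k)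
  invSum-map k f (τ ∷ L) inv≡ = begin
    mono (inv (f τ)) ⊕ invSum (map f L)         ≡⟨ cong (λ e → mono e ⊕ invSum (map f L)) (inv≡ (here refl)) ⟩
    mono (k + inv τ) ⊕ invSum (map f L)         ≈⟨ ⊕-congˡ {mono (k + inv τ)} (invSum-map k f L (inv≡ ∘ there)) ⟩
    mono (k + inv τ) ⊕ shift k (invSum L)       ≡⟨ cong (_⊕ shift k (invSum L)) (shift-mono k (inv τ)) ⟨
    shift k (mono (inv τ)) ⊕ shift k (invSum L) ≈⟨ shift-⊕ k (mono (inv τ)) (invSum L) ⟨
    shift k (mono (inv τ) ⊕ invSum L)           ∎

  invSum-concatMap : ∀ (f : ℕ → List (List ℕ)) (g : ℕ → Poly) is → (∀ {i} → i ∈ is → invSum (f i) ≋ g i) →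
    invSum (concatMap f is) ≋ sumP (map g is)
  invSum-concatMap f g []       _  = ≋-refl
  invSum-concatMap f g (i ∷ is) f≋g = begin
    invSum (f i ++ concatMap f is)           ≈⟨ invSum-++ (f i) (concatMap f is) ⟩
    invSum (f i) ⊕ invSum (concatMap f is)   ≈⟨ ⊕-cong (f≋g (here refl)) (invSum-concatMap f g is (f≋g ∘ there)) ⟩
    g i ⊕ sumP (map g is)                    ∎

module Recurrence (j : ℕ) where
  open Decomposition j
  open Relation.Binary.Reasoning.Setoid ≋-setoid

  F-recurrence : F (suc M) ≋ shift M (F M) ⊕ F M
    ⊕ sumP (map (λ i → shift ((2 + i) * (j ∸ i) + (j ∸ i) C 2) (F (suc i))) (upTo j))
  F-recurrence = begin
    F (suc M)                     ≈⟨ invSum-↭ avoiders↭pieces ⟩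
    invSum (first ++ rest)        ≈⟨ invSum-++ first rest ⟩
    invSum first ⊕ invSum rest    ≈⟨ ⊕-cong first-sum (invSum-++ (map (glue M 0) (avoiders M)) _) ⟩
    shift M (F M) ⊕ (invSum (map (glue M 0) (avoiders M)) ⊕ invSum (concatMap inner (upTo j)))
                                  ≈⟨ ⊕-congˡ {shift M (F M)} (⊕-cong zero-sum inner-sum) ⟩
    shift M (F M) ⊕ (F M ⊕ tail)  ≈⟨ ⊕-assoc (shift M (F M)) (F M) tail ⟨
    shift M (F M) ⊕ F M ⊕ tail    ∎
    where
    tail : Poly
    tail = sumP (map (λ i → shift ((2 + i) * (j ∸ i) + (j ∸ i) C 2) (F (suc i))) (upTo j))
    first-sum : invSum first ≋ shift M (F M)
    first-sum = invSum-map M (M ∷_) (avoiders M) λ {τ} τ∈ → let open IsPerm (∈-avoiders⇒IsPerm {M} τ∈) in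
      trans (inv-max-∷ {M} bounded) (cong (_+ inv τ) length≡)
    zero-sum : invSum (map (glue M 0) (avoiders M)) ≋ F M
    zero-sum = invSum-map 0 (glue M 0) (avoiders M) λ {α} α∈ →
      trans (Glue.inv-glue (+-identityʳ M) (∈-avoiders⇒IsPerm α∈)) (cong (λ z → z + 0 + inv α) (*-zeroʳ (suc M)))
    inner-sum : invSum (concatMap inner (upTo j)) ≋ tail
    inner-sum = invSum-concatMap inner _ (upTo j) λ {i} i∈ →
      invSum-map _ (glue M (j ∸ i)) (avoiders (suc i)) λ α∈ →
        Glue.inv-glue (suc-i+[j∸i]≡M (∈.∈-upTo⁻ i∈)) (∈-avoiders⇒IsPerm α∈)

theorem6p3 : (F 1 ≈ oneP)
    × (∀ (n : ℕ) → 2 ≤ n →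
         F n ≈ shift (n ∸ 1) (F (n ∸ 1)) ⊕ F (n ∸ 1)
               ⊕ sumP (map (λ i → shift ((2 + i) * (n ∸ (2 + i)) + ((n ∸ (2 + i)) C 2)) (F ((2 + i) ∸ 1)))
                           (upTo (n ∸ 2))))
theorem6p3 = (λ _ → refl) , λ { (suc (suc j)) (s≤s (s≤s z≤n)) → _≋_.coeff-≡ (Recurrence.F-recurrence j) }
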